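{- Let $\Sigma$ be an alphabet with $|\Sigma|=k\geq 2$ and let $m\geq 1$. The probability that a word of length $m$ chosen uniformly at random from $\Sigma^m$ is periodic does not exceed $k^{1-\lceil m/2\rceil}$.
   Context: An alphabet is a nonempty, finite, totally ordered set $\Sigma$; a word of length $m$ is a sequence $[a_1,\ldots,a_m]$ with $a_i\in\Sigma$, ordered lexicographically. A rotation of $[a_1,\ldots,a_m]$ is a word $[a_i,\ldots,a_m,a_1,\ldots,a_{i-1}]$. A word is a Lyndon word if it is strictly smaller (lexicographically) than each of its nontrivial rotations. For a word $w$, $lexmin(w)$ denotes its lexicographically smallest rotation. A word $w$ is aperiodic if $lexmin(w)$ is a Lyndon word, and periodic otherwise. -}

module Defs where

open import Data.Nat using (ℕ; zero; suc; _≤_; _<_; _<ᵇ_)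
open import Data.Fin using (Fin)
import Data.Fin.Properties as FinP
open import Data.List using (List; []; _∷_; _++_; map; concatMap; allFin; drop; take; length; upTo; foldr; filter)
open import Data.List.Relation.Binary.Lex.Strict using (<-decidable)
open import Data.List.Relation.Binary.Lex using (Lex-<)
open import Data.List.Relation.Unary.All using (All; all?)
open import Relation.Binary.PropositionalEquality using (_≡_)
open import Relation.Nullary using (Dec; yes; no; ¬_; ¬?)
open import Relation.Nullary.Decidable using (does)
open import Data.Bool using (if_then_else_)

-- The alphabet Σ with |Σ| = k is (up to order isomorphism) Fin k with its
-- natural total order; a word is a list of letters.
Word : ℕ → Set
Word k = List (Fin k)

_<ₗ_ : ∀ {k} → Word k → Word k → Set
_<ₗ_ = Lex-< _≡_ Data.Fin._<_

_<ₗ?_ : ∀ {k} (u v : Word k) → Dec (u <ₗ v)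
_<ₗ?_ = <-decidable FinP._≟_ FinP._<?_

rotate : ∀ {k} → ℕ → Word k → Word k
rotate i w = drop i w ++ take i w

rotations : ∀ {k} → Word k → List (Word k)
rotations w = map (λ i → rotate i w) (upTo (length w))

lexmin : ∀ {k} → Word k → Word k
lexmin w = foldr (λ u v → if does (u <ₗ? v) then u else v) w (rotations w)

nontrivial : ℕ → List ℕ
nontrivial zero = []
nontrivial (suc n) = map suc (upTo n)

Lyndon : ∀ {k} → Word k → Set
Lyndon w = All (λ i → w <ₗ rotate i w) (nontrivial (length w))

Lyndon? : ∀ {k} (w : Word k) → Dec (Lyndon w)
Lyndon? w = all? (λ i → w <ₗ? rotate i w) (nontrivial (length w))

Periodic : ∀ {k} → Word k → Set
Periodic w = ¬ Lyndon (lexmin w)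

Periodic? : ∀ {k} (w : Word k) → Dec (Periodic w)
Periodic? w = ¬? (Lyndon? (lexmin w))

words : (k m : ℕ) → List (Word k)
words k zero = [] ∷ []
words k (suc m) = concatMap (λ w → map (_∷ w) (allFin k)) (words k m)

#periodic : (k m : ℕ) → ℕ
#periodic k m = length (filter Periodic? (words k m))

{-# OPTIONS --safe #-}
module Submission where

-- Let v = lexmin w = rotate r w. If v is not Lyndon, some nontrivial rotation
-- rotate j v is not larger than v; being itself a rotation of w it is not smaller
-- either, so rotate j v ≡ v, and since rotations commute also rotate j w ≡ w.
-- Writing w = x ++ y with |x| = j, this says x ++ y ≡ y ++ x, so w is the
-- length-m prefix of a power of the shorter of x and y, a word of length at most
-- ⌊m/2⌋. Hence there are at most k + k² + ⋯ + k^⌊m/2⌋ < k^(⌊m/2⌋+1) periodic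
-- words, and ⌊m/2⌋ + 1 + (⌈m/2⌉ − 1) = m.

open import Defs
open import Data.Bool using (if_then_else_)
open import Data.Empty using (⊥-elim)
import Data.Fin.Properties as Fin
open import Data.List
  using (List; []; _∷_; _++_; map; concat; concatMap; replicate; take; drop; length; filter; allFin; cartesianProductWith)
open import Data.List.Membership.Propositional using (_∈_; find)
open import Data.List.Membership.Propositional.Properties
  using (∈-map⁺; ∈-map⁻; ∈-upTo⁺; ∈-upTo⁻; ∈-allFin; ∈-filter⁻; ∈-∃++; ∈-++⁻; ∈-++⁺ˡ; ∈-++⁺ʳ;
         ∈-cartesianProductWith⁺; ∈-cartesianProductWith⁻; foldr-selective)
open import Data.List.Properties
  using (++-assoc; ++-identityʳ; length-++; length-++-comm; length-take; take++drop≡id; length-map; length-tabulate;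
         ∷-injective; foldr-forcesᵇ)
import Data.List.Relation.Binary.Lex.Strict as Lex
open import Data.List.Relation.Binary.Pointwise using (Pointwise-≡⇒≡; ≡⇒Pointwise-≡)
open import Data.List.Relation.Binary.Subset.Propositional using (_⊆_)
open import Data.List.Relation.Unary.All using ([]) renaming (lookup to All-lookup)
open import Data.List.Relation.Unary.All.Properties using (¬All⇒Any¬)
open import Data.List.Relation.Unary.AllPairs using ([]; _∷_)
open import Data.List.Relation.Unary.Any using (here; there)
open import Data.List.Relation.Unary.Unique.Propositional using (Unique)
import Data.List.Relation.Unary.Unique.Propositional.Properties as Unique
open import Data.Nat
  using (ℕ; zero; suc; _+_; _*_; _^_; _∸_; _≤_; _<_; z≤n; s≤s; s≤s⁻¹; _<?_; _%_; NonZero; ⌊_/2⌋; ⌈_/2⌉)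
open import Data.Nat.DivMod using (m%n<n; m<n⇒m%n≡m; [m+n]%n≡m%n)
open import Data.Nat.Properties
open import Algebra.Properties.CommutativeSemigroup +-commutativeSemigroup using (x∙yz≈y∙xz)
open import Data.Product using (∃; ∃₂; _×_; _,_; swap)
open import Data.Sum using (_⊎_; inj₁; inj₂)
open import Function using (_∘_)
open import Relation.Binary.Definitions using (tri<; tri≈; tri>)
open import Relation.Binary.PropositionalEquality
open import Relation.Binary.Structures using (IsStrictTotalOrder)
open import Relation.Nullary using (¬_; yes; no)
open import Relation.Nullary.Decidable using (does)

m≤n⇒m≤⌊m+n/2⌋ : ∀ {m n} → m ≤ n → m ≤ ⌊ m + n /2⌋
m≤n⇒m≤⌊m+n/2⌋ {m} {n} m≤n = subst (_≤ ⌊ m + n /2⌋) (sym (n≡⌊n+n/2⌋ m)) (⌊n/2⌋-mono (+-monoʳ-≤ m m≤n))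

module _ {A : Set} where

  ++-split : ∀ i (w : List A) → i ≤ length w → ∃₂ λ x y → length x ≡ i × x ++ y ≡ w
  ++-split i w i≤ = take i w , drop i w , trans (length-take i w) (m≤n⇒m⊓n≡m i≤) , take++drop≡id i w

  take-length-++ : ∀ (x y : List A) → take (length x) (x ++ y) ≡ x
  take-length-++ []      y = refl
  take-length-++ (c ∷ x) y = cong (c ∷_) (take-length-++ x y)

  drop-length-++ : ∀ (x y : List A) → drop (length x) (x ++ y) ≡ y
  drop-length-++ []      y = refl
  drop-length-++ (c ∷ x) y = drop-length-++ x y

  take-length-+-++ : ∀ n (x y : List A) → take (length x + n) (x ++ y) ≡ x ++ take n y
  take-length-+-++ n []      y = refl
  take-length-+-++ n (c ∷ x) y = cong (c ∷_) (take-length-+-++ n x y)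

  take-++-≤ : ∀ n (x y : List A) → n ≤ length x → take n (x ++ y) ≡ take n x
  take-++-≤ zero    x       y n≤       = refl
  take-++-≤ (suc n) (c ∷ x) y (s≤s n≤) = cong (c ∷_) (take-++-≤ n x y n≤)

  power : ℕ → List A → List A
  power n a = concat (replicate n a)

  length-power : ∀ n (a : List A) → length (power n a) ≡ n * length a
  length-power zero    a = refl
  length-power (suc n) a = trans (length-++ a) (cong (length a +_) (length-power n a))

  power-comm : ∀ n {a b : List A} → a ++ b ≡ b ++ a → power n a ++ b ≡ b ++ power n a
  power-comm zero    {a} {b} comm = sym (++-identityʳ b)
  power-comm (suc n) {a} {b} comm = begin
    (a ++ power n a) ++ b  ≡⟨ ++-assoc a (power n a) b ⟩
    a ++ power n a ++ b    ≡⟨ cong (a ++_) (power-comm n comm) ⟩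
    a ++ b ++ power n a    ≡⟨ sym (++-assoc a b (power n a)) ⟩
    (a ++ b) ++ power n a  ≡⟨ cong (_++ power n a) comm ⟩
    (b ++ a) ++ power n a  ≡⟨ ++-assoc b a (power n a) ⟩
    b ++ a ++ power n a    ∎
    where open ≡-Reasoning

  commuting⇒prefix-of-power : ∀ n {a b : List A} → a ++ b ≡ b ++ a → length b ≤ n * length a →
                              b ≡ take (length b) (power n a)
  commuting⇒prefix-of-power n {a} {b} comm b≤ = begin
    b                                   ≡⟨ sym (take-length-++ b (power n a)) ⟩
    take (length b) (b ++ power n a)    ≡⟨ cong (take (length b)) (sym (power-comm n comm)) ⟩
    take (length b) (power n a ++ b)    ≡⟨ take-++-≤ (length b) (power n a) b (≤-trans b≤ (≤-reflexive (sym (length-power n a)))) ⟩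
    take (length b) (power n a)         ∎
    where open ≡-Reasoning

  takeCycle : ℕ → List A → List A
  takeCycle m a = take m (power m a)

  commuting⇒takeCycle : ∀ (a b : List A) → a ++ b ≡ b ++ a → 1 ≤ length a →
                        a ++ b ≡ takeCycle (length a + length b) a
  commuting⇒takeCycle a@(_ ∷ a′) b comm _ = begin
    a ++ b                                       ≡⟨ cong (a ++_) (commuting⇒prefix-of-power n comm b≤n*|a|) ⟩
    a ++ take (length b) (power n a)             ≡⟨ sym (take-length-+-++ (length b) a (power n a)) ⟩
    take (length a + length b) (a ++ power n a)  ∎
    where
    open ≡-Reasoning
    n = length a′ + length b
    b≤n*|a| : length b ≤ n * length a
    b≤n*|a| = ≤-trans (m≤n+m (length b) (length a′)) (m≤m*n n (length a))

  commuting⇒short-period : ∀ (x y : List A) → x ++ y ≡ y ++ x → 1 ≤ length x → 1 ≤ length y →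
    ∃ λ a → 1 ≤ length a × length a ≤ ⌊ length x + length y /2⌋ × x ++ y ≡ takeCycle (length x + length y) a
  commuting⇒short-period x y comm 1≤x 1≤y with ≤-total (length x) (length y)
  ... | inj₁ x≤y = x , 1≤x , m≤n⇒m≤⌊m+n/2⌋ x≤y , commuting⇒takeCycle x y comm 1≤x
  ... | inj₂ y≤x = y , 1≤y , subst (λ n → length y ≤ ⌊ n /2⌋) y+x≡x+y (m≤n⇒m≤⌊m+n/2⌋ y≤x) ,
                   trans comm (subst (λ n → y ++ x ≡ takeCycle n y) y+x≡x+y (commuting⇒takeCycle y x (sym comm) 1≤y))
    where
    y+x≡x+y : length y + length x ≡ length x + length y
    y+x≡x+y = +-comm (length y) (length x)

  unique-⊆⇒length-≤ : ∀ {xs ys : List A} → Unique xs → xs ⊆ ys → length xs ≤ length ys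
  unique-⊆⇒length-≤ {[]}     _             _     = z≤n
  unique-⊆⇒length-≤ {x ∷ xs} (x∉xs ∷ xs!) xs⊆ys with ∈-∃++ (xs⊆ys (here refl))
  ... | ys₁ , ys₂ , refl = begin
    suc (length xs)                ≤⟨ s≤s (unique-⊆⇒length-≤ xs! xs⊆ys₁++ys₂) ⟩
    suc (length (ys₁ ++ ys₂))      ≡⟨ cong suc (length-++ ys₁) ⟩
    suc (length ys₁ + length ys₂)  ≡⟨ sym (+-suc (length ys₁) (length ys₂)) ⟩
    length ys₁ + length (x ∷ ys₂)  ≡⟨ sym (length-++ ys₁) ⟩
    length (ys₁ ++ x ∷ ys₂)        ∎
    where
    open ≤-Reasoning
    xs⊆ys₁++ys₂ : xs ⊆ ys₁ ++ ys₂
    xs⊆ys₁++ys₂ {y} y∈xs with ∈-++⁻ ys₁ (xs⊆ys (there y∈xs))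
    ... | inj₁ y∈ys₁         = ∈-++⁺ˡ y∈ys₁
    ... | inj₂ (here y≡x)    = ⊥-elim (All-lookup x∉xs y∈xs (sym y≡x))
    ... | inj₂ (there y∈ys₂) = ∈-++⁺ʳ ys₁ y∈ys₂

concatMap-map≡cartesianProductWith : ∀ {A B C : Set} (f : A → B → C) xs ys →
  concatMap (λ x → map (f x) ys) xs ≡ cartesianProductWith f xs ys
concatMap-map≡cartesianProductWith f []       ys = refl
concatMap-map≡cartesianProductWith f (x ∷ xs) ys = cong (map (f x) ys ++_) (concatMap-map≡cartesianProductWith f xs ys)

length-cartesianProductWith : ∀ {A B C : Set} (f : A → B → C) xs ys →
  length (cartesianProductWith f xs ys) ≡ length xs * length ys
length-cartesianProductWith f []       ys = refl
length-cartesianProductWith f (x ∷ xs) ys = begin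
  length (map (f x) ys ++ cartesianProductWith f xs ys)          ≡⟨ length-++ (map (f x) ys) ⟩
  length (map (f x) ys) + length (cartesianProductWith f xs ys)  ≡⟨ cong₂ _+_ (length-map (f x) ys) (length-cartesianProductWith f xs ys) ⟩
  length ys + length xs * length ys                              ∎
  where open ≡-Reasoning

module _ {k : ℕ} where

  rotate-++ : ∀ (x y : Word k) → rotate (length x) (x ++ y) ≡ y ++ x
  rotate-++ x y = cong₂ _++_ (drop-length-++ x y) (take-length-++ x y)

  length-rotate : ∀ i (w : Word k) → length (rotate i w) ≡ length w
  length-rotate i w = trans (length-++-comm (drop i w) (take i w)) (cong length (take++drop≡id i w))

  rotate-length : ∀ (w : Word k) → rotate (length w) w ≡ w
  rotate-length w = trans (cong (rotate (length w)) (sym (++-identityʳ w))) (rotate-++ w [])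

  rotate-+ : ∀ r j (w : Word k) → r + j ≤ length w → rotate j (rotate r w) ≡ rotate (r + j) w
  rotate-+ r j w r+j≤ with ++-split r w (m+n≤o⇒m≤o r r+j≤)
  ... | x , y , refl , refl with ++-split j y (+-cancelˡ-≤ (length x) j (length y) (≤-trans r+j≤ (≤-reflexive (length-++ x))))
  ... | y₁ , y₂ , refl , refl = begin
    rotate (length y₁) (rotate (length x) (x ++ y₁ ++ y₂))  ≡⟨ cong (rotate (length y₁)) (rotate-++ x (y₁ ++ y₂)) ⟩
    rotate (length y₁) ((y₁ ++ y₂) ++ x)                    ≡⟨ cong (rotate (length y₁)) (++-assoc y₁ y₂ x) ⟩
    rotate (length y₁) (y₁ ++ y₂ ++ x)                      ≡⟨ rotate-++ y₁ (y₂ ++ x) ⟩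
    (y₂ ++ x) ++ y₁                                         ≡⟨ ++-assoc y₂ x y₁ ⟩
    y₂ ++ x ++ y₁                                           ≡⟨ sym (rotate-++ (x ++ y₁) y₂) ⟩
    rotate (length (x ++ y₁)) ((x ++ y₁) ++ y₂)             ≡⟨ cong₂ rotate (length-++ x) (++-assoc x y₁ y₂) ⟩
    rotate (length x + length y₁) (x ++ y₁ ++ y₂)           ∎
    where open ≡-Reasoning

  rotate-inverse : ∀ r s (w : Word k) → r + s ≡ length w → rotate s (rotate r w) ≡ w
  rotate-inverse r s w r+s≡ = begin
    rotate s (rotate r w)  ≡⟨ rotate-+ r s w (≤-reflexive r+s≡) ⟩
    rotate (r + s) w       ≡⟨ cong (λ i → rotate i w) r+s≡ ⟩
    rotate (length w) w    ≡⟨ rotate-length w ⟩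
    w                      ∎
    where open ≡-Reasoning

  rotate-injective : ∀ r {u v : Word k} → r ≤ length u → length u ≡ length v → rotate r u ≡ rotate r v → u ≡ v
  rotate-injective r {u} {v} r≤ |u|≡|v| eq with s , r+s≡ ← m≤n⇒∃[o]m+o≡n r≤ = begin
    u                      ≡⟨ sym (rotate-inverse r s u r+s≡) ⟩
    rotate s (rotate r u)  ≡⟨ cong (rotate s) eq ⟩
    rotate s (rotate r v)  ≡⟨ rotate-inverse r s v (trans r+s≡ |u|≡|v|) ⟩
    v                      ∎
    where open ≡-Reasoning

  rotate-rotate : ∀ r j (w : Word k) .{{_ : NonZero (length w)}} → r < length w → j < length w →
                  rotate j (rotate r w) ≡ rotate ((r + j) % length w) w
  rotate-rotate r j w r<m j<m with r + j <? length w
  ... | yes r+j<m = trans (rotate-+ r j w (<⇒≤ r+j<m)) (cong (λ i → rotate i w) (sym (m<n⇒m%n≡m r+j<m)))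
  ... | no r+j≮m
    with t , m+t≡r+j ← m≤n⇒∃[o]m+o≡n (≮⇒≥ r+j≮m)
       | s , r+s≡m   ← m≤n⇒∃[o]m+o≡n (<⇒≤ r<m) = begin
    rotate j (rotate r w)               ≡⟨ cong (λ i → rotate i (rotate r w)) j≡s+t ⟩
    rotate (s + t) (rotate r w)         ≡⟨ sym (rotate-+ s t (rotate r w) s+t≤) ⟩
    rotate t (rotate s (rotate r w))    ≡⟨ cong (rotate t) (rotate-inverse r s w r+s≡m) ⟩
    rotate t w                          ≡⟨ cong (λ i → rotate i w) (sym [r+j]%m≡t) ⟩
    rotate ((r + j) % length w) w       ∎
    where
    open ≡-Reasoning
    m = length w
    j≡s+t : j ≡ s + t
    j≡s+t = +-cancelˡ-≡ r j (s + t) (begin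
      r + j        ≡⟨ sym m+t≡r+j ⟩
      m + t        ≡⟨ cong (_+ t) (sym r+s≡m) ⟩
      r + s + t    ≡⟨ +-assoc r s t ⟩
      r + (s + t)  ∎)
    s+t≤ : s + t ≤ length (rotate r w)
    s+t≤ = ≤-trans (≤-reflexive (sym j≡s+t)) (≤-trans (<⇒≤ j<m) (≤-reflexive (sym (length-rotate r w))))
    t<m : t < m
    t<m = +-cancelˡ-< m t m (subst (_< m + m) (sym m+t≡r+j) (+-mono-< r<m j<m))
    [r+j]%m≡t : (r + j) % m ≡ t
    [r+j]%m≡t = begin
      (r + j) % m  ≡⟨ cong (_% m) (trans (sym m+t≡r+j) (+-comm m t)) ⟩
      (t + m) % m  ≡⟨ [m+n]%n≡m%n t m ⟩
      t % m        ≡⟨ m<n⇒m%n≡m t<m ⟩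
      t            ∎

  rotate-comm : ∀ r j (w : Word k) → r < length w → j < length w → rotate j (rotate r w) ≡ rotate r (rotate j w)
  rotate-comm r j w@(_ ∷ _) r<m j<m = begin
    rotate j (rotate r w)          ≡⟨ rotate-rotate r j w r<m j<m ⟩
    rotate ((r + j) % length w) w  ≡⟨ cong (λ i → rotate (i % length w) w) (+-comm r j) ⟩
    rotate ((j + r) % length w) w  ≡⟨ sym (rotate-rotate j r w j<m r<m) ⟩
    rotate r (rotate j w)          ∎
    where open ≡-Reasoning

  rotate-∈-rotations : ∀ {i} (w : Word k) → i < length w → rotate i w ∈ rotations w
  rotate-∈-rotations w i<m = ∈-map⁺ (λ i → rotate i w) (∈-upTo⁺ i<m)

  ∈-rotations⁻ : ∀ {u : Word k} (w : Word k) → u ∈ rotations w → ∃ λ i → i < length w × u ≡ rotate i w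
  ∈-rotations⁻ w u∈ with i , i∈ , u≡ ← ∈-map⁻ (λ i → rotate i w) u∈ = i , ∈-upTo⁻ i∈ , u≡

  rotate-preserves-∈-rotations : ∀ {j} {u : Word k} (w : Word k) → u ∈ rotations w → j < length w → rotate j u ∈ rotations w
  rotate-preserves-∈-rotations {j} w@(_ ∷ _) u∈ j<m with r , r<m , refl ← ∈-rotations⁻ w u∈ =
    subst (_∈ rotations w) (sym (rotate-rotate r j w r<m j<m)) (rotate-∈-rotations w (m%n<n (r + j) (length w)))

  rotate-fixed-reflects : ∀ r j (w : Word k) → r < length w → j < length w →
                          rotate j (rotate r w) ≡ rotate r w → rotate j w ≡ w
  rotate-fixed-reflects r j w r<m j<m fixed =
    rotate-injective r (≤-trans (<⇒≤ r<m) (≤-reflexive (sym (length-rotate j w)))) (length-rotate j w)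
      (trans (sym (rotate-comm r j w r<m j<m)) fixed)

  <ₗ-isStrictTotalOrder : IsStrictTotalOrder _ (_<ₗ_ {k})
  <ₗ-isStrictTotalOrder = Lex.<-isStrictTotalOrder Fin.<-isStrictTotalOrder

  open IsStrictTotalOrder <ₗ-isStrictTotalOrder using (compare) renaming (trans to <ₗ-trans)

  <ₗ-irrefl : ∀ {u : Word k} → ¬ (u <ₗ u)
  <ₗ-irrefl = IsStrictTotalOrder.irrefl <ₗ-isStrictTotalOrder (≡⇒Pointwise-≡ refl)

  ≮ₗ⇒≥ₗ : ∀ {u v : Word k} → ¬ (u <ₗ v) → v ≡ u ⊎ v <ₗ u
  ≮ₗ⇒≥ₗ {u} {v} u≮v with compare u v
  ... | tri< u<v _   _   = ⊥-elim (u≮v u<v)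
  ... | tri≈ _   u≈v _   = inj₁ (sym (Pointwise-≡⇒≡ u≈v))
  ... | tri> _   _   v<u = inj₂ v<u

  minₗ : Word k → Word k → Word k
  minₗ u v = if does (u <ₗ? v) then u else v

  minₗ-sel : ∀ u v → minₗ u v ≡ u ⊎ minₗ u v ≡ v
  minₗ-sel u v with u <ₗ? v
  ... | yes _ = inj₁ refl
  ... | no  _ = inj₂ refl

  minₗ-forces : ∀ {x} u v → x <ₗ minₗ u v → x <ₗ u × x <ₗ v
  minₗ-forces u v x<min with u <ₗ? v
  ... | yes u<v = x<min , <ₗ-trans x<min u<v
  ... | no  u≮v with ≮ₗ⇒≥ₗ u≮v
  ...   | inj₁ refl = x<min , x<min
  ...   | inj₂ v<u  = <ₗ-trans x<min v<u , x<min

  lexmin-∈-rotations : ∀ (w : Word k) → 0 < length w → lexmin w ∈ rotations w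
  lexmin-∈-rotations w 0<m with foldr-selective minₗ-sel w (rotations w)
  ... | inj₁ lexmin≡w = subst (_∈ rotations w) (sym (trans lexmin≡w (sym (++-identityʳ w)))) (rotate-∈-rotations w 0<m)
  ... | inj₂ lexmin∈  = lexmin∈

  lexmin-minimal : ∀ {u} (w : Word k) → u ∈ rotations w → ¬ (u <ₗ lexmin w)
  lexmin-minimal {u} w u∈ u<lexmin =
    <ₗ-irrefl (All-lookup (foldr-forcesᵇ {P = u <ₗ_} minₗ-forces w (rotations w) u<lexmin) u∈)

  ∈-nontrivial⁻ : ∀ {j} n → j ∈ nontrivial n → 1 ≤ j × j < n
  ∈-nontrivial⁻ (suc n) j∈ with i , i∈ , refl ← ∈-map⁻ suc j∈ = s≤s z≤n , s≤s (∈-upTo⁻ i∈)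

  periodic⇒rotation-fixed : ∀ (w : Word k) → Periodic w → ∃ λ j → 1 ≤ j × j < length w × rotate j w ≡ w
  periodic⇒rotation-fixed []          notLyndon = ⊥-elim (notLyndon [])
  periodic⇒rotation-fixed w@(_ ∷ _) notLyndon
    with r , r<m , v≡ ← ∈-rotations⁻ w (lexmin-∈-rotations w (s≤s z≤n))
       | j , j∈ , v≮rotate ← find (¬All⇒Any¬ (λ i → lexmin w <ₗ? rotate i (lexmin w)) _ notLyndon)
    with 1≤j , j<|v| ← ∈-nontrivial⁻ (length (lexmin w)) j∈
    = j , 1≤j , j<m , rotate-fixed-reflects r j w r<m j<m rotate-fixes-v
    where
    v = lexmin w
    j<m : j < length w
    j<m = subst (j <_) (trans (cong length v≡) (length-rotate r w)) j<|v|
    rotate≮v : ¬ (rotate j v <ₗ v)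
    rotate≮v = lexmin-minimal w (rotate-preserves-∈-rotations w (lexmin-∈-rotations w (s≤s z≤n)) j<m)
    rotate-fixes-v : rotate j (rotate r w) ≡ rotate r w
    rotate-fixes-v with ≮ₗ⇒≥ₗ v≮rotate
    ... | inj₁ rotate≡v = subst (λ u → rotate j u ≡ u) v≡ rotate≡v
    ... | inj₂ rotate<v = ⊥-elim (rotate≮v rotate<v)

  rotation-fixed⇒short-period : ∀ j (w : Word k) → 1 ≤ j → j < length w → rotate j w ≡ w →
    ∃ λ a → 1 ≤ length a × length a ≤ ⌊ length w /2⌋ × w ≡ takeCycle (length w) a
  rotation-fixed⇒short-period j w 1≤j j<m fixed with x , y , refl , refl ← ++-split j w (<⇒≤ j<m)
    rewrite length-++ x {y} =
    commuting⇒short-period x y (trans (sym fixed) (rotate-++ x y)) 1≤j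
      (+-cancelˡ-≤ (length x) 1 (length y) (subst (_≤ length x + length y) (+-comm 1 (length x)) j<m))

  periodic⇒short-period : ∀ (w : Word k) → Periodic w →
    ∃ λ a → 1 ≤ length a × length a ≤ ⌊ length w /2⌋ × w ≡ takeCycle (length w) a
  periodic⇒short-period w periodic with j , 1≤j , j<m , fixed ← periodic⇒rotation-fixed w periodic =
    rotation-fixed⇒short-period j w 1≤j j<m fixed

module _ (k : ℕ) where

  words-suc : ∀ m → words k (suc m) ≡ cartesianProductWith (λ w c → c ∷ w) (words k m) (allFin k)
  words-suc m = concatMap-map≡cartesianProductWith (λ w c → c ∷ w) (words k m) (allFin k)

  length-words : ∀ m → length (words k m) ≡ k ^ m
  length-words zero    = refl
  length-words (suc m) = begin
    length (words k (suc m))                                              ≡⟨ cong length (words-suc m) ⟩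
    length (cartesianProductWith (λ w c → c ∷ w) (words k m) (allFin k))  ≡⟨ length-cartesianProductWith _ (words k m) (allFin k) ⟩
    length (words k m) * length (allFin k)                                ≡⟨ cong₂ _*_ (length-words m) (length-tabulate (λ i → i)) ⟩
    k ^ m * k                                                             ≡⟨ *-comm (k ^ m) k ⟩
    k ^ suc m                                                             ∎
    where open ≡-Reasoning

  words-unique : ∀ m → Unique (words k m)
  words-unique zero    = [] ∷ []
  words-unique (suc m) = subst Unique (sym (words-suc m))
    (Unique.cartesianProductWith⁺ (λ w c → c ∷ w) (swap ∘ ∷-injective) (words-unique m) (Unique.allFin⁺ k))

  ∈-words : ∀ (w : Word k) → w ∈ words k (length w)
  ∈-words []      = here refl
  ∈-words (c ∷ w) = subst (c ∷ w ∈_) (sym (words-suc (length w)))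
    (∈-cartesianProductWith⁺ (λ w c → c ∷ w) (∈-words w) (∈-allFin c))

  ∈-words⁻ : ∀ m {w : Word k} → w ∈ words k m → length w ≡ m
  ∈-words⁻ zero    (here refl) = refl
  ∈-words⁻ (suc m) w∈ with v , c , v∈ , _ , refl ←
    ∈-cartesianProductWith⁻ (λ w c → c ∷ w) (words k m) (allFin k) (subst (_ ∈_) (words-suc m) w∈) =
    cong suc (∈-words⁻ m v∈)

  nonemptyWords : ℕ → List (Word k)
  nonemptyWords zero    = []
  nonemptyWords (suc h) = words k (suc h) ++ nonemptyWords h

  ∈-nonemptyWords : ∀ h (a : Word k) → 1 ≤ length a → length a ≤ h → a ∈ nonemptyWords h
  ∈-nonemptyWords zero    a 1≤a a≤0 = ⊥-elim (<-irrefl refl (≤-trans 1≤a a≤0))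
  ∈-nonemptyWords (suc h) a 1≤a a≤h with m≤n⇒m<n∨m≡n a≤h
  ... | inj₁ a<h = ∈-++⁺ʳ (words k (suc h)) (∈-nonemptyWords h a 1≤a (s≤s⁻¹ a<h))
  ... | inj₂ a≡h = ∈-++⁺ˡ (subst (λ n → a ∈ words k n) a≡h (∈-words a))

  -- The extra k is what makes the bound k + ⋯ + k^h < k^(h+1) go through by induction.
  k+length-nonemptyWords≤ : 2 ≤ k → ∀ h → k + length (nonemptyWords h) ≤ k ^ suc h
  k+length-nonemptyWords≤ 2≤k zero    = ≤-reflexive (trans (+-identityʳ k) (sym (*-identityʳ k)))
  k+length-nonemptyWords≤ 2≤k (suc h) = begin
    k + length (words k (suc h) ++ nonemptyWords h)  ≡⟨ cong (k +_) (length-++ (words k (suc h))) ⟩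
    k + (length (words k (suc h)) + L)               ≡⟨ cong (λ n → k + (n + L)) (length-words (suc h)) ⟩
    k + (K + L)                                      ≡⟨ x∙yz≈y∙xz k K L ⟩
    K + (k + L)                                      ≤⟨ +-monoʳ-≤ K (k+length-nonemptyWords≤ 2≤k h) ⟩
    K + K                                            ≡⟨ cong (K +_) (sym (+-identityʳ K)) ⟩
    2 * K                                            ≤⟨ *-monoˡ-≤ K 2≤k ⟩
    k * K                                            ∎
    where
    open ≤-Reasoning
    K = k ^ suc h
    L = length (nonemptyWords h)

  periodic-words⊆ : ∀ m → filter Periodic? (words k m) ⊆ map (takeCycle m) (nonemptyWords ⌊ m /2⌋)
  periodic-words⊆ m {w} w∈ with w∈words , periodic ← ∈-filter⁻ Periodic? w∈
    with a , 1≤a , a≤ , w≡ ← periodic⇒short-period w periodic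
    rewrite ∈-words⁻ m w∈words =
    subst (_∈ _) (sym w≡) (∈-map⁺ (takeCycle m) (∈-nonemptyWords ⌊ m /2⌋ a 1≤a a≤))

  #periodic≤ : ∀ m → #periodic k m ≤ length (nonemptyWords ⌊ m /2⌋)
  #periodic≤ m = ≤-trans
    (unique-⊆⇒length-≤ (Unique.filter⁺ Periodic? (words-unique m)) (periodic-words⊆ m))
    (≤-reflexive (length-map (takeCycle m) (nonemptyWords ⌊ m /2⌋)))

corollary1 : (k m : ℕ) → 2 ≤ k → 1 ≤ m →
    #periodic k m * k ^ (⌈ m /2⌉ ∸ 1) ≤ k ^ m
corollary1 k (suc n) 2≤k _ = begin
  #periodic k (suc n) * k ^ ⌊ n /2⌋  ≤⟨ *-monoˡ-≤ (k ^ ⌊ n /2⌋) #periodic≤k^[h+1] ⟩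
  k ^ suc h * k ^ ⌊ n /2⌋            ≡⟨ sym (^-distribˡ-+-* k (suc h) ⌊ n /2⌋) ⟩
  k ^ (suc h + ⌊ n /2⌋)              ≡⟨ cong (k ^_) (trans (sym (+-suc h ⌊ n /2⌋)) (⌊n/2⌋+⌈n/2⌉≡n (suc n))) ⟩
  k ^ suc n                          ∎
  where
  open ≤-Reasoning
  h = ⌊ suc n /2⌋
  #periodic≤k^[h+1] : #periodic k (suc n) ≤ k ^ suc h
  #periodic≤k^[h+1] = ≤-trans (#periodic≤ k (suc n)) (m+n≤o⇒n≤o k (k+length-nonemptyWords≤ k 2≤k h))
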